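{- Consider an application of Res$'$ with main premise $C=\lnot A_1\lor\dots\lor\lnot A_n\lor D$, side premises $C_1=B_1\lor D_1,\dots,C_t=B_t\lor D_t$, and mgu $\sigma$ (so $A_i\sigma=B_i\sigma$ for $i\le t$). Let $x$ be a top variable, and let $A_1,\dots,A_s$ ($s\le t$, after reordering) be the atoms containing $x$. Then (1) $var(A_1,\dots,A_s)=var(C)$; (2) $var(x\sigma)=var(C\sigma)$; (3) $var(x\sigma)=var(y\sigma)$ whenever $x,y$ are distinct top variables.
   Context: $var(E)$: variables of $E$. Variable depth: $vdp(t)=-1$ if $t$ ground, $0$ if a variable, $1+\max_i vdp(u_i)$ for non-ground $f(u_1,\dots,u_n)$. Flat: $vdp\le0$; simple: $vdp\le1$. A non-ground compound literal contains a non-ground compound term. A compound term $t$ is weakly covering if $var(s)=var(t)$ for each non-ground compound subterm $s$; a clause $C$ (resp. literal $L$) is weakly covering if each of its terms is ground, a variable, or a weakly covering term $t$ with $var(t)=var(C)$ (resp. $var(L)$). LGC: a simple, weakly covering clause which, if non-ground, contains flat negative literals $\lnot G_1,\dots,\lnot G_m$ (guards) such that each pair of its variables co-occurs in some $G_j$. Ordering: $\succ$ is a lexicographic path ordering with precedence function symbols $>$ constants $>$ predicate symbols, extended admissibly to literals; $L$ is strictly $\succ$-maximal in $C$ if no $L'\in C$ satisfies $L'\succeq L$. Query pair: flat atoms $A_1,\dots,A_n$ (not all ground) and weakly covering simple atoms $B_1,\dots,B_n$, each a non-ground compound literal or ground, $var(\overline A)\cap var(\overline B)=\emptyset$, $B_i$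 pairwise variable-disjoint, and a simultaneous mgu $\sigma_0$ with $A_i\sigma_0=B_i\sigma_0$ for all $i$. Top variable: $x\in var(\overline A)$ with $vdp(x\sigma_0)\ge vdp(y\sigma_0)$ for all $y\in var(\overline A)$. Res$'$: main premise $C=\lnot A_1\lor\dots\lor\lnot A_n\lor D$, a non-ground flat LGC with $D$ positive; side premises LGCs $C_i=B_i\lor D_i$ ($1\le i\le n$), pairwise variable-disjoint and disjoint from $C$, with no literal selected and $B_i$ strictly $\succ$-maximal w.r.t. $C_i$, such that $(A_1,\dots,A_n;B_1,\dots,B_n)$ is a query pair. Reorder so that $A_1,\dots,A_t$ are exactly the atoms containing a top variable; with $\sigma$ an mgu such that $A_i\sigma=B_i\sigma$ ($1\le i\le t$), the resolvent is $(D_1\lor\dots\lor D_t\lor\lnot A_{t+1}\lor\dots\lor\lnot A_n\lor D)\sigma$. -}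

module Defs where

open import Data.Nat using (ℕ; zero; suc)
open import Data.Integer using (ℤ; +_; -[1+_]; _⊔_) renaming (_≤_ to _≤ℤ_)
open import Data.List using (List; []; _∷_; map; _++_)
open import Data.List.Relation.Unary.Any using (Any)
open import Data.List.Relation.Unary.All using (All)
open import Data.List.Membership.Propositional using (_∈_)
open import Data.Vec using (Vec; lookup; toList)
open import Data.Fin using (Fin)
open import Data.Product using (Σ; ∃; _×_; _,_)
open import Data.Sum using (_⊎_)
open import Data.Empty using (⊥)
open import Data.Unit using (⊤)
open import Relation.Nullary using (¬_)
open import Relation.Binary.PropositionalEquality using (_≡_; _≢_)

-- First-order syntax.  Variables are natural numbers; a function symbol
-- is a name (ℕ); its arity is the length of its argument list.
-- Constants are function symbols applied to [].

data Term : Set where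
  var : ℕ → Term
  fn  : ℕ → List Term → Term

data Atom : Set where
  atom : ℕ → List Term → Atom

data Literal : Set where
  pos : Atom → Literal
  neg : Atom → Literal

Clause : Set
Clause = List Literal

args : Atom → List Term
args (atom _ ts) = ts

atomOf : Literal → Atom
atomOf (pos A) = A
atomOf (neg A) = A

IsPos : Literal → Set
IsPos (pos _) = ⊤
IsPos (neg _) = ⊥

IsNeg : Literal → Set
IsNeg (pos _) = ⊥
IsNeg (neg _) = ⊤

data _∈T_ (x : ℕ) : Term → Set where
  here : x ∈T var x
  arg  : ∀ {f ts} → Any (x ∈T_) ts → x ∈T fn f ts

_∈A_ : ℕ → Atom → Set
x ∈A A = Any (x ∈T_) (args A)

_∈L_ : ℕ → Literal → Set
x ∈L L = x ∈A atomOf L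

_∈C_ : ℕ → Clause → Set
x ∈C C = Any (x ∈L_) C

_≃V_ : (ℕ → Set) → (ℕ → Set) → Set
P ≃V Q = ∀ y → (P y → Q y) × (Q y → P y)

GroundT : Term → Set
GroundT t = ∀ x → ¬ x ∈T t

GroundA : Atom → Set
GroundA A = ∀ x → ¬ x ∈A A

GroundC : Clause → Set
GroundC C = ∀ x → ¬ x ∈C C

IsVar : Term → Set
IsVar (var _)  = ⊤
IsVar (fn _ _) = ⊥

IsCompound : Term → Set
IsCompound (var _)  = ⊥
IsCompound (fn _ _) = ⊤

-- Variable depth: -1 for ground, 0 for a variable,
-- 1 + max of argument depths for a non-ground compound term.

bump : ℤ → ℤ
bump (+ n)    = + suc n
bump -[1+ n ] = -[1+ 0 ]     -- all arguments ground: the term is ground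

mutual
  vdp : Term → ℤ
  vdp (var _)   = + 0
  vdp (fn _ ts) = bump (vdps ts)

  vdps : List Term → ℤ
  vdps []       = -[1+ 0 ]
  vdps (t ∷ ts) = vdp t ⊔ vdps ts

vdpA : Atom → ℤ
vdpA A = vdps (args A)

FlatA : Atom → Set
FlatA A = vdpA A ≤ℤ + 0

SimpleA : Atom → Set
SimpleA A = vdpA A ≤ℤ + 1

FlatL : Literal → Set
FlatL L = FlatA (atomOf L)

SimpleC : Clause → Set
SimpleC C = All (λ L → SimpleA (atomOf L)) C

FlatC : Clause → Set
FlatC C = All FlatL C

NGCompoundA : Atom → Set
NGCompoundA A = Any (λ t → IsCompound t × ¬ GroundT t) (args A)

data _⊴_ (s : Term) : Term → Set where
  self : s ⊴ s
  sub  : ∀ {f ts} → Any (s ⊴_) ts → s ⊴ fn f ts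

WeaklyCoveringT : Term → Set
WeaklyCoveringT t =
  IsCompound t ×
  (∀ s → s ⊴ t → IsCompound s → ¬ GroundT s → (_∈T s) ≃V (_∈T t))

-- a term allowed in a weakly covering expression whose variable set is V
WCArg : (ℕ → Set) → Term → Set
WCArg V t = GroundT t ⊎ IsVar t ⊎ (WeaklyCoveringT t × ((_∈T t) ≃V V))

WeaklyCoveringA : Atom → Set
WeaklyCoveringA A = All (WCArg (_∈A A)) (args A)

WeaklyCoveringC : Clause → Set
WeaklyCoveringC C = All (λ L → All (WCArg (_∈C C)) (args (atomOf L))) C

Guarded : Clause → Set
Guarded C = ∀ x y → x ∈C C → y ∈C C →
  ∃ λ G → neg G ∈ C × FlatA G × x ∈A G × y ∈A G

LGC : Clause → Set
LGC C = SimpleC C × WeaklyCoveringC C × (¬ GroundC C → Guarded C)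

Subst : Set
Subst = ℕ → Term

mutual
  _⟨_⟩ : Term → Subst → Term
  var x   ⟨ σ ⟩ = σ x
  fn f ts ⟨ σ ⟩ = fn f (ts ⟨ σ ⟩*)

  _⟨_⟩* : List Term → Subst → List Term
  []       ⟨ σ ⟩* = []
  (t ∷ ts) ⟨ σ ⟩* = t ⟨ σ ⟩ ∷ ts ⟨ σ ⟩*

_⟨_⟩A : Atom → Subst → Atom
atom p ts ⟨ σ ⟩A = atom p (ts ⟨ σ ⟩*)

_⟨_⟩L : Literal → Subst → Literal
pos A ⟨ σ ⟩L = pos (A ⟨ σ ⟩A)
neg A ⟨ σ ⟩L = neg (A ⟨ σ ⟩A)

_⟨_⟩C : Clause → Subst → Clause
C ⟨ σ ⟩C = map (_⟨ σ ⟩L) C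

Unifies : ∀ {n} → (Fin n → Set) → Vec Atom n → Vec Atom n → Subst → Set
Unifies P A B σ = ∀ i → P i → lookup A i ⟨ σ ⟩A ≡ lookup B i ⟨ σ ⟩A

IsMGU : ∀ {n} → (Fin n → Set) → Vec Atom n → Vec Atom n → Subst → Set
IsMGU P A B σ = Unifies P A B σ ×
  (∀ θ → Unifies P A B θ → ∃ λ δ → ∀ x → θ x ≡ σ x ⟨ δ ⟩)

-- Lexicographic path ordering.  Atoms are treated as terms whose head is
-- a predicate symbol.  A symbol is identified by its name and arity.

data Sym : Set where
  fs : ℕ → ℕ → Sym    -- function symbol (name, arity); arity 0 = constant
  ps : ℕ → ℕ → Sym

data GT : Set where
  gv   : ℕ → GT
  gapp : Sym → List GT → GT

mutual
  ⌜_⌝ : Term → GT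
  ⌜ var x ⌝   = gv x
  ⌜ fn f ts ⌝ = gapp (fs f (Data.List.length ts)) ⌜ ts ⌝*

  ⌜_⌝* : List Term → List GT
  ⌜ [] ⌝*     = []
  ⌜ t ∷ ts ⌝* = ⌜ t ⌝ ∷ ⌜ ts ⌝*

⌜_⌝A : Atom → GT
⌜ atom p ts ⌝A = gapp (ps p (Data.List.length ts)) ⌜ ts ⌝*

record Precedence : Set₁ where
  field
    _>p_      : Sym → Sym → Set
    irrefl    : ∀ s → ¬ (s >p s)
    trans     : ∀ {a b c} → a >p b → b >p c → a >p c
    fun>const : ∀ f k c → fs f (suc k) >p fs c 0
    const>pred : ∀ c p k → fs c 0 >p ps p k
    fun>pred  : ∀ f k p m → fs f (suc k) >p ps p m

module LPO (_>p_ : Sym → Sym → Set) where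
  mutual
    data _≻_ : GT → GT → Set where
      lpo-sub : ∀ {f ss t} → Any (_≽ t) ss → gapp f ss ≻ t
      lpo-prec : ∀ {f g ss ts} → f >p g → All (gapp f ss ≻_) ts →
                 gapp f ss ≻ gapp g ts
      lpo-lex : ∀ {f ss ts} → Lex ss ts → All (gapp f ss ≻_) ts →
                gapp f ss ≻ gapp f ts

    data _≽_ : GT → GT → Set where
      ≽-refl : ∀ {s} → s ≽ s
      ≽-gt   : ∀ {s t} → s ≻ t → s ≽ t

    data Lex : List GT → List GT → Set where
      lex-here  : ∀ {s t ss ts} → s ≻ t → Lex (s ∷ ss) (t ∷ ts)
      lex-there : ∀ {s ss ts} → Lex ss ts → Lex (s ∷ ss) (s ∷ ts)

  data _≻L_ : Literal → Literal → Set where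
    by-atom : ∀ {L L'} → ⌜ atomOf L ⌝A ≻ ⌜ atomOf L' ⌝A → L ≻L L'
    by-sign : ∀ {A} → neg A ≻L pos A

  -- L (occupying a position of the clause L ∷ D) is strictly maximal
  StrictlyMaximal : Literal → Clause → Set
  StrictlyMaximal L D = ∀ L' → L' ∈ D → ¬ (L' ≻L L ⊎ L' ≡ L)

VarsAll : ∀ {n} → Vec Atom n → ℕ → Set
VarsAll A x = ∃ λ i → x ∈A lookup A i

mainPremise : ∀ {n} → Vec Atom n → Clause → Clause
mainPremise A D = map neg (toList A) ++ D

sidePremise : Atom → Clause → Clause
sidePremise B D = pos B ∷ D

record ResApp (prec : Precedence) (Sel : Clause → Literal → Set) : Set where
  open Precedence prec
  open LPO _>p_
  field
    n  : ℕ
    A  : Vec Atom n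
    D  : Clause
    B  : Vec Atom n
    Ds : Vec Clause n
    σ₀ : Subst
  C : Clause
  C = mainPremise A D
  Cs : Fin n → Clause
  Cs i = sidePremise (lookup B i) (lookup Ds i)
  Top : ℕ → Set
  Top x = VarsAll A x × (∀ y → VarsAll A y → vdp (σ₀ y) ≤ℤ vdp (σ₀ x))
  HasTop : Fin n → Set
  HasTop i = ∃ λ x → Top x × x ∈A lookup A i
  field
    σ  : Subst
    C-LGC       : LGC C
    C-flat      : FlatC C
    C-nonground : ¬ GroundC C
    D-positive  : All IsPos D
    Cs-LGC      : ∀ i → LGC (Cs i)
    Cs-nosel    : ∀ i L → L ∈ Cs i → ¬ Sel (Cs i) L
    Cs-max      : ∀ i → StrictlyMaximal (pos (lookup B i)) (lookup Ds i)
    Cs-disj     : ∀ i j → i ≢ j → ∀ x → x ∈C Cs i → ¬ x ∈C Cs j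
    Cs-disj-C   : ∀ i x → x ∈C Cs i → ¬ x ∈C C
    A-flat      : ∀ i → FlatA (lookup A i)
    A-nonground : ¬ (∀ i → GroundA (lookup A i))
    B-wc        : ∀ i → WeaklyCoveringA (lookup B i)
    B-simple    : ∀ i → SimpleA (lookup B i)
    B-shape     : ∀ i → NGCompoundA (lookup B i) ⊎ GroundA (lookup B i)
    AB-disj     : ∀ x → VarsAll A x → ¬ VarsAll B x
    B-disj      : ∀ i j → i ≢ j → ∀ x → x ∈A lookup B i → ¬ x ∈A lookup B j
    σ₀-mgu      : IsMGU (λ _ → ⊤) A B σ₀
    σ-mgu       : IsMGU HasTop A B σ

-- Part (1) holds because C is loosely guarded: any two variables of C share a guard, and
-- since D is positive every guard is one of the Aᵢ.  For (2), if σ₀ x is ground then so is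
-- σ₀ y for every variable y of the Aᵢ (x has maximal depth), and σ, being more special than
-- σ₀ on those variables, grounds them all.  Otherwise take an atom Aⱼ containing x: x is an
-- argument of Aⱼ (Aⱼ is flat), and its partner t in Bⱼ is neither ground (σ₀ x is not) nor a
-- variable (a variable of Bⱼ lies in a compound argument of Bⱼ, whose partner in Aⱼ would
-- then be deeper under σ₀ than the top variable x).  So t is weakly covering with the
-- variables of Bⱼ, whence var(Aⱼσ) = var(Bⱼσ) = var(tσ) = var(xσ).  Part (3) follows from (2).
module Submission where

open import Defs
open import Data.Nat using (ℕ; z≤n; s≤s) renaming (_≟_ to _≟ℕ_)
open import Data.Nat.Properties using (n≤1+n)
open import Data.Integer using (+_; -[1+_]; +≤+; -≤-; -<+; +<+)
  renaming (_≤_ to _≤ℤ_; _<_ to _<ℤ_)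
import Data.Integer.Properties as ℤ
open import Data.List using ([]; _∷_; map)
open import Data.List.Properties using (∷-injectiveˡ; ∷-injectiveʳ)
open import Data.List.Relation.Unary.Any using (Any; here; there)
import Data.List.Relation.Unary.Any as Any
import Data.List.Relation.Unary.Any.Properties as Any
import Data.List.Relation.Unary.All as All
open import Data.List.Relation.Binary.Pointwise using (Pointwise; []; _∷_)
import Data.List.Relation.Binary.Pointwise as Pointwise
open import Data.List.Membership.Propositional using (_∈_; find; lose)
open import Data.List.Membership.Propositional.Properties using (∈-map⁺; ∈-map⁻; ∈-++⁺ˡ; ∈-++⁻)
open import Data.Vec using (lookup)
import Data.Vec.Relation.Unary.Any as VecAny
open import Data.Vec.Relation.Unary.Any.Properties using (lookup-index)
open import Data.Vec.Membership.Propositional.Properties using (∈-lookup; ∈-toList⁺; ∈-toList⁻)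
import Data.Fin.Properties as Fin
open import Data.Product using (∃; _×_; _,_; proj₁; proj₂)
open import Data.Sum using (_⊎_; inj₁; inj₂)
open import Data.Empty using (⊥-elim)
open import Data.Unit using (⊤; tt)
open import Relation.Nullary using (¬_; Dec; yes; no)
open import Relation.Nullary.Decidable using (_×-dec_)
open import Relation.Unary using (Decidable)
open import Relation.Binary.PropositionalEquality
  using (_≡_; _≢_; refl; sym; trans; cong; cong₂; subst; module ≡-Reasoning)

≃V-sym : ∀ {P Q} → P ≃V Q → Q ≃V P
≃V-sym P≃Q y = proj₂ (P≃Q y) , proj₁ (P≃Q y)

≃V-trans : ∀ {P Q S} → P ≃V Q → Q ≃V S → P ≃V S
≃V-trans P≃Q Q≃S y = (λ p → proj₁ (Q≃S y) (proj₁ (P≃Q y) p)) , (λ s → proj₂ (P≃Q y) (proj₂ (Q≃S y) s))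

mutual
  ∈T-⟨⟩⁺ : ∀ σ {z w} t → z ∈T t → w ∈T σ z → w ∈T (t ⟨ σ ⟩)
  ∈T-⟨⟩⁺ σ (var z)   here      w∈ = w∈
  ∈T-⟨⟩⁺ σ (fn f ts) (arg z∈) w∈ = arg (∈T*-⟨⟩⁺ σ ts z∈ w∈)

  ∈T*-⟨⟩⁺ : ∀ σ {z w} ts → Any (z ∈T_) ts → w ∈T σ z → Any (w ∈T_) (ts ⟨ σ ⟩*)
  ∈T*-⟨⟩⁺ σ (t ∷ ts) (here z∈)  w∈ = here (∈T-⟨⟩⁺ σ t z∈ w∈)
  ∈T*-⟨⟩⁺ σ (t ∷ ts) (there z∈) w∈ = there (∈T*-⟨⟩⁺ σ ts z∈ w∈)

mutual
  ∈T-⟨⟩⁻ : ∀ σ {w} t → w ∈T (t ⟨ σ ⟩) → ∃ λ z → z ∈T t × w ∈T σ z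
  ∈T-⟨⟩⁻ σ (var z)   w∈       = z , here , w∈
  ∈T-⟨⟩⁻ σ (fn f ts) (arg w∈) =
    let z , z∈ , w∈σz = ∈T*-⟨⟩⁻ σ ts w∈ in z , arg z∈ , w∈σz

  ∈T*-⟨⟩⁻ : ∀ σ {w} ts → Any (w ∈T_) (ts ⟨ σ ⟩*) → ∃ λ z → Any (z ∈T_) ts × w ∈T σ z
  ∈T*-⟨⟩⁻ σ (t ∷ ts) (here w∈)  = let z , z∈ , w∈σz = ∈T-⟨⟩⁻ σ t w∈   in z , here z∈ , w∈σz
  ∈T*-⟨⟩⁻ σ (t ∷ ts) (there w∈) = let z , z∈ , w∈σz = ∈T*-⟨⟩⁻ σ ts w∈ in z , there z∈ , w∈σz

∈A-⟨⟩⁺ : ∀ σ {z w} A → z ∈A A → w ∈T σ z → w ∈A (A ⟨ σ ⟩A)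
∈A-⟨⟩⁺ σ (atom p ts) = ∈T*-⟨⟩⁺ σ ts

∈A-⟨⟩⁻ : ∀ σ {w} A → w ∈A (A ⟨ σ ⟩A) → ∃ λ z → z ∈A A × w ∈T σ z
∈A-⟨⟩⁻ σ (atom p ts) = ∈T*-⟨⟩⁻ σ ts

∈L-⟨⟩⁺ : ∀ σ {z w} L → z ∈L L → w ∈T σ z → w ∈L (L ⟨ σ ⟩L)
∈L-⟨⟩⁺ σ (pos A) = ∈A-⟨⟩⁺ σ A
∈L-⟨⟩⁺ σ (neg A) = ∈A-⟨⟩⁺ σ A

∈L-⟨⟩⁻ : ∀ σ {w} L → w ∈L (L ⟨ σ ⟩L) → ∃ λ z → z ∈L L × w ∈T σ z
∈L-⟨⟩⁻ σ (pos A) = ∈A-⟨⟩⁻ σ A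
∈L-⟨⟩⁻ σ (neg A) = ∈A-⟨⟩⁻ σ A

∈C-⟨⟩⁺ : ∀ σ {z w} C → z ∈C C → w ∈T σ z → w ∈C (C ⟨ σ ⟩C)
∈C-⟨⟩⁺ σ C z∈ w∈ = Any.map⁺ (Any.map (λ {L} z∈L → ∈L-⟨⟩⁺ σ L z∈L w∈) z∈)

∈C-⟨⟩⁻ : ∀ σ {w} C → w ∈C (C ⟨ σ ⟩C) → ∃ λ z → z ∈C C × w ∈T σ z
∈C-⟨⟩⁻ σ C w∈ =
  let L , L∈C , w∈Lσ = find (Any.map⁻ w∈)
      z , z∈L , w∈σz = ∈L-⟨⟩⁻ σ L w∈Lσ
  in z , lose L∈C z∈L , w∈σz

ground-⟨⟩ : ∀ σ t → GroundT t → GroundT (t ⟨ σ ⟩)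
ground-⟨⟩ σ t t-ground w w∈ = let z , z∈ , _ = ∈T-⟨⟩⁻ σ t w∈ in t-ground z z∈

mutual
  ground-or-occurs : ∀ t → GroundT t ⊎ ∃ (_∈T t)
  ground-or-occurs (var x) = inj₂ (x , here)
  ground-or-occurs (fn f ts) with ground-or-occurs* ts
  ... | inj₁ ts-ground  = inj₁ λ { x (arg x∈) → ts-ground x x∈ }
  ... | inj₂ (x , x∈) = inj₂ (x , arg x∈)

  ground-or-occurs* : ∀ ts → (∀ x → ¬ Any (x ∈T_) ts) ⊎ ∃ λ x → Any (x ∈T_) ts
  ground-or-occurs* [] = inj₁ λ _ ()
  ground-or-occurs* (t ∷ ts) with ground-or-occurs t | ground-or-occurs* ts
  ... | inj₂ (x , x∈) | _             = inj₂ (x , here x∈)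
  ... | inj₁ _        | inj₂ (x , x∈) = inj₂ (x , there x∈)
  ... | inj₁ t-ground | inj₁ ts-ground =
    inj₁ λ { x (here x∈) → t-ground x x∈ ; x (there x∈) → ts-ground x x∈ }

groundA? : ∀ A → Dec (GroundA A)
groundA? A with ground-or-occurs* (args A)
... | inj₁ A-ground = yes A-ground
... | inj₂ (x , x∈) = no λ A-ground → A-ground x x∈

mutual
  _∈T?_ : ∀ x t → Dec (x ∈T t)
  x ∈T? var y with x ≟ℕ y
  ... | yes refl = yes here
  ... | no x≢y   = no λ { here → x≢y refl }
  x ∈T? fn f ts with x ∈T*? ts
  ... | yes x∈ = yes (arg x∈)
  ... | no x∉  = no λ { (arg x∈) → x∉ x∈ }

  _∈T*?_ : ∀ x ts → Dec (Any (x ∈T_) ts)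
  x ∈T*? [] = no λ ()
  x ∈T*? (t ∷ ts) with x ∈T? t | x ∈T*? ts
  ... | yes x∈ | _      = yes (here x∈)
  ... | no _   | yes x∈ = yes (there x∈)
  ... | no x∉t | no x∉ts = no λ { (here x∈) → x∉t x∈ ; (there x∈) → x∉ts x∈ }

_∈A?_ : ∀ x A → Dec (x ∈A A)
x ∈A? A = x ∈T*? args A

mutual
  ⟨⟩-cong : ∀ {θ₁ θ₂} t → (∀ z → z ∈T t → θ₁ z ≡ θ₂ z) → t ⟨ θ₁ ⟩ ≡ t ⟨ θ₂ ⟩
  ⟨⟩-cong (var z)   agree = agree z here
  ⟨⟩-cong (fn f ts) agree = cong (fn f) (⟨⟩*-cong ts λ z z∈ → agree z (arg z∈))

  ⟨⟩*-cong : ∀ {θ₁ θ₂} ts → (∀ z → Any (z ∈T_) ts → θ₁ z ≡ θ₂ z) → ts ⟨ θ₁ ⟩* ≡ ts ⟨ θ₂ ⟩*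
  ⟨⟩*-cong []       agree = refl
  ⟨⟩*-cong (t ∷ ts) agree =
    cong₂ _∷_ (⟨⟩-cong t λ z z∈ → agree z (here z∈)) (⟨⟩*-cong ts λ z z∈ → agree z (there z∈))

⟨⟩A-cong : ∀ {θ₁ θ₂} A → (∀ z → z ∈A A → θ₁ z ≡ θ₂ z) → A ⟨ θ₁ ⟩A ≡ A ⟨ θ₂ ⟩A
⟨⟩A-cong (atom p ts) agree = cong (atom p) (⟨⟩*-cong ts agree)

choose : ∀ {P : ℕ → Set} → Decidable P → Subst → Subst → Subst
choose P? θ₁ θ₂ v with P? v
... | yes _ = θ₁ v
... | no _  = θ₂ v

choose-yes : ∀ {P : ℕ → Set} (P? : Decidable P) θ₁ θ₂ {v} → P v → choose P? θ₁ θ₂ v ≡ θ₁ v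
choose-yes P? θ₁ θ₂ {v} p with P? v
... | yes _ = refl
... | no ¬p = ⊥-elim (¬p p)

choose-no : ∀ {P : ℕ → Set} (P? : Decidable P) θ₁ θ₂ {v} → ¬ P v → choose P? θ₁ θ₂ v ≡ θ₂ v
choose-no P? θ₁ θ₂ {v} ¬p with P? v
... | yes p = ⊥-elim (¬p p)
... | no _  = refl

args-⟨⟩ : ∀ σ A B → A ⟨ σ ⟩A ≡ B ⟨ σ ⟩A → args A ⟨ σ ⟩* ≡ args B ⟨ σ ⟩*
args-⟨⟩ σ (atom p ts) (atom q us) = cong args

⟨⟩*-≡⇒Pointwise : ∀ σ ts us → ts ⟨ σ ⟩* ≡ us ⟨ σ ⟩* → Pointwise (λ a b → a ⟨ σ ⟩ ≡ b ⟨ σ ⟩) ts us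
⟨⟩*-≡⇒Pointwise σ []       []       _  = []
⟨⟩*-≡⇒Pointwise σ (t ∷ ts) (u ∷ us) eq = ∷-injectiveˡ eq ∷ ⟨⟩*-≡⇒Pointwise σ ts us (∷-injectiveʳ eq)

Pointwise-∩ : ∀ {R S : Term → Term → Set} {ts us} →
  Pointwise R ts us → Pointwise S ts us → Pointwise (λ a b → R a b × S a b) ts us
Pointwise-∩ []         []         = []
Pointwise-∩ (r ∷ rs) (s ∷ ss) = (r , s) ∷ Pointwise-∩ rs ss

Pointwise-∈ : ∀ {R : Term → Term → Set} {ts us a} →
  Pointwise R ts us → a ∈ ts → ∃ λ b → b ∈ us × R a b
Pointwise-∈ (r ∷ _)  (here refl) = _ , here refl , r
Pointwise-∈ (_ ∷ rs) (there a∈)  = let b , b∈ , r = Pointwise-∈ rs a∈ in b , there b∈ , r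

i≤bump[i] : ∀ i → i ≤ℤ bump i
i≤bump[i] (+ n)    = +≤+ (n≤1+n n)
i≤bump[i] -[1+ n ] = -≤- z≤n

0≤i≤j⇒i<bump[j] : ∀ {i j} → + 0 ≤ℤ i → i ≤ℤ j → i <ℤ bump j
0≤i≤j⇒i<bump[j] {+ m} {+ k} _ (+≤+ m≤k) = +<+ (s≤s m≤k)

0≤i⇒bump[i]≰0 : ∀ {i} → + 0 ≤ℤ i → ¬ bump i ≤ℤ + 0
0≤i⇒bump[i]≰0 {+ m} _ (+≤+ ())

mutual
  0≤vdp : ∀ {x} t → x ∈T t → + 0 ≤ℤ vdp t
  0≤vdp (var _)   here     = +≤+ z≤n
  0≤vdp (fn f ts) (arg x∈) = ℤ.≤-trans (0≤vdps ts x∈) (i≤bump[i] _)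

  0≤vdps : ∀ {x} ts → Any (x ∈T_) ts → + 0 ≤ℤ vdps ts
  0≤vdps (t ∷ ts) (here x∈)  = ℤ.≤-trans (0≤vdp t x∈) (ℤ.i≤i⊔j _ _)
  0≤vdps (t ∷ ts) (there x∈) = ℤ.≤-trans (0≤vdps ts x∈) (ℤ.i≤j⊔i _ _)

mutual
  vdp-ground : ∀ t → GroundT t → vdp t ≡ -[1+ 0 ]
  vdp-ground (var x)   t-ground = ⊥-elim (t-ground x here)
  vdp-ground (fn f ts) t-ground = cong bump (vdps-ground ts λ x x∈ → t-ground x (arg x∈))

  vdps-ground : ∀ ts → (∀ x → ¬ Any (x ∈T_) ts) → vdps ts ≡ -[1+ 0 ]
  vdps-ground []       _         = refl
  vdps-ground (t ∷ ts) ts-ground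
    rewrite vdp-ground t (λ x x∈ → ts-ground x (here x∈))
          | vdps-ground ts (λ x x∈ → ts-ground x (there x∈)) = refl

mutual
  vdp-var≤vdp-⟨⟩ : ∀ σ {z} t → z ∈T t → vdp (σ z) ≤ℤ vdp (t ⟨ σ ⟩)
  vdp-var≤vdp-⟨⟩ σ (var z)   here     = ℤ.≤-refl
  vdp-var≤vdp-⟨⟩ σ (fn f ts) (arg z∈) = ℤ.≤-trans (vdp-var≤vdps-⟨⟩* σ ts z∈) (i≤bump[i] _)

  vdp-var≤vdps-⟨⟩* : ∀ σ {z} ts → Any (z ∈T_) ts → vdp (σ z) ≤ℤ vdps (ts ⟨ σ ⟩*)
  vdp-var≤vdps-⟨⟩* σ (t ∷ ts) (here z∈)  = ℤ.≤-trans (vdp-var≤vdp-⟨⟩ σ t z∈) (ℤ.i≤i⊔j _ _)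
  vdp-var≤vdps-⟨⟩* σ (t ∷ ts) (there z∈) = ℤ.≤-trans (vdp-var≤vdps-⟨⟩* σ ts z∈) (ℤ.i≤j⊔i _ _)

vdp-var<vdp-⟨⟩-fn : ∀ σ {z w} f ts → Any (z ∈T_) ts → w ∈T σ z → vdp (σ z) <ℤ vdp (fn f ts ⟨ σ ⟩)
vdp-var<vdp-⟨⟩-fn σ {z} f ts z∈ w∈ = 0≤i≤j⇒i<bump[j] (0≤vdp (σ z) w∈) (vdp-var≤vdps-⟨⟩* σ ts z∈)

vdp≤ground⇒ground : ∀ t u → vdp t ≤ℤ vdp u → GroundT u → GroundT t
vdp≤ground⇒ground t u t≤u u-ground x x∈ =
  ℤ.≤⇒≯ (ℤ.≤-trans (0≤vdp t x∈) (subst (vdp t ≤ℤ_) (vdp-ground u u-ground) t≤u)) -<+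

vdps≤⇒vdp≤ : ∀ {c t} ts → vdps ts ≤ℤ c → t ∈ ts → vdp t ≤ℤ c
vdps≤⇒vdp≤ (t ∷ ts) ≤c (here refl) = ℤ.≤-trans (ℤ.i≤i⊔j _ _) ≤c
vdps≤⇒vdp≤ (t ∷ ts) ≤c (there t∈)  = vdps≤⇒vdp≤ ts (ℤ.≤-trans (ℤ.i≤j⊔i _ _) ≤c) t∈

flat⇒var⊎ground : ∀ t → vdp t ≤ℤ + 0 → (∃ λ u → t ≡ var u) ⊎ GroundT t
flat⇒var⊎ground (var u)   _    = inj₁ (u , refl)
flat⇒var⊎ground (fn f ts) flat = inj₂ λ { x (arg x∈) → 0≤i⇒bump[i]≰0 (0≤vdps ts x∈) flat }

module _ {prec : Precedence} {Sel : Clause → Literal → Set} (R : ResApp prec Sel) where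
  open ResApp R
  open ≡-Reasoning

  ∈A⇒∈C : ∀ {x} i → x ∈A lookup A i → x ∈C C
  ∈A⇒∈C i = lose (∈-++⁺ˡ (∈-map⁺ neg (∈-toList⁺ (∈-lookup i A))))

  negative-literal-of-C : ∀ {G} → neg G ∈ C → ∃ λ i → G ≡ lookup A i
  negative-literal-of-C G∈ with ∈-++⁻ (map neg _) G∈
  ... | inj₂ G∈D = ⊥-elim (All.lookup D-positive G∈D)
  ... | inj₁ G∈A with ∈-map⁻ neg G∈A
  ... | _ , a∈ , refl = let a∈A = ∈-toList⁻ a∈ in VecAny.index a∈A , lookup-index a∈A

  co-occurring≃vars-C : ∀ {x} → VarsAll A x →
    (λ y → ∃ λ i → x ∈A lookup A i × y ∈A lookup A i) ≃V (_∈C C)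
  co-occurring≃vars-C {x} (k , x∈Ak) y = (λ (i , _ , y∈Ai) → ∈A⇒∈C i y∈Ai) , share-a-guard
    where
    share-a-guard : y ∈C C → ∃ λ i → x ∈A lookup A i × y ∈A lookup A i
    share-a-guard y∈C with proj₂ (proj₂ C-LGC) C-nonground x y (∈A⇒∈C k x∈Ak) y∈C
    ... | G , G∈C , _ , x∈G , y∈G with negative-literal-of-C G∈C
    ... | i , refl = i , x∈G , y∈G

  top-is-deepest : ∀ {x y} → Top x → VarsAll A y → ¬ vdp (σ₀ x) <ℤ vdp (σ₀ y)
  top-is-deepest (_ , deepest) y∈A = ℤ.≤⇒≯ (deepest _ y∈A)

  σ₀-args : ∀ j → Pointwise (λ a b → a ⟨ σ₀ ⟩ ≡ b ⟨ σ₀ ⟩) (args (lookup A j)) (args (lookup B j))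
  σ₀-args j = ⟨⟩*-≡⇒Pointwise σ₀ _ _ (args-⟨⟩ σ₀ (lookup A j) (lookup B j) (proj₁ σ₀-mgu j tt))

  σ-args : ∀ j → HasTop j → Pointwise (λ a b → a ⟨ σ ⟩ ≡ b ⟨ σ ⟩) (args (lookup A j)) (args (lookup B j))
  σ-args j hasTop = ⟨⟩*-≡⇒Pointwise σ _ _ (args-⟨⟩ σ (lookup A j) (lookup B j) (proj₁ σ-mgu j hasTop))

  module _ {x} (x-top : Top x) (σ₀x-ground : GroundT (σ₀ x)) where

    σ₀-grounds-A : ∀ {y} → VarsAll A y → GroundT (σ₀ y)
    σ₀-grounds-A y∈A = vdp≤ground⇒ground _ _ (proj₂ x-top _ y∈A) σ₀x-ground

    every-var-of-A-is-top : ∀ {y} → VarsAll A y → Top y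
    every-var-of-A-is-top y∈A = y∈A , λ z z∈A →
      ℤ.≤-reflexive (trans (vdp-ground _ (σ₀-grounds-A z∈A)) (sym (vdp-ground _ (σ₀-grounds-A y∈A))))

    InGroundPair : ℕ → Set
    InGroundPair v = ∃ λ j → GroundA (lookup A j) × v ∈A lookup B j

    inGroundPair? : Decidable InGroundPair
    inGroundPair? v = Fin.any? λ j → groundA? (lookup A j) ×-dec (v ∈A? lookup B j)

    -- σ₀ on the variables of the Bⱼ paired with a ground Aⱼ (pairs that σ need not unify),
    -- σ elsewhere: a unifier of all pairs that agrees with σ on the variables of the Aᵢ.
    θ : Subst
    θ = choose inGroundPair? σ₀ σ

    θ≡σ-on-A : ∀ {v} → VarsAll A v → θ v ≡ σ v
    θ≡σ-on-A v∈A = choose-no inGroundPair? σ₀ σ λ (j , _ , v∈Bj) → AB-disj _ v∈A (j , v∈Bj)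

    θ-unifies : Unifies (λ _ → ⊤) A B θ
    θ-unifies i _ with ground-or-occurs* (args (lookup A i))
    ... | inj₁ Ai-ground = begin
      lookup A i ⟨ θ ⟩A  ≡⟨ ⟨⟩A-cong (lookup A i) (λ z z∈ → ⊥-elim (Ai-ground z z∈)) ⟩
      lookup A i ⟨ σ₀ ⟩A ≡⟨ proj₁ σ₀-mgu i tt ⟩
      lookup B i ⟨ σ₀ ⟩A ≡⟨ ⟨⟩A-cong (lookup B i) (λ z z∈ → sym (choose-yes inGroundPair? σ₀ σ (i , Ai-ground , z∈))) ⟩
      lookup B i ⟨ θ ⟩A  ∎
    ... | inj₂ (y , y∈Ai) = begin
      lookup A i ⟨ θ ⟩A ≡⟨ ⟨⟩A-cong (lookup A i) (λ z z∈ → θ≡σ-on-A (i , z∈)) ⟩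
      lookup A i ⟨ σ ⟩A ≡⟨ proj₁ σ-mgu i (y , every-var-of-A-is-top (i , y∈Ai) , y∈Ai) ⟩
      lookup B i ⟨ σ ⟩A ≡⟨ ⟨⟩A-cong (lookup B i) (λ z z∈ → sym (choose-no inGroundPair? σ₀ σ (not-in-ground-pair z∈))) ⟩
      lookup B i ⟨ θ ⟩A ∎
      where
      not-in-ground-pair : ∀ {z} → z ∈A lookup B i → ¬ InGroundPair z
      not-in-ground-pair z∈Bi (j , Aj-ground , z∈Bj) with i Fin.≟ j
      ... | yes refl = Aj-ground y y∈Ai
      ... | no i≢j   = B-disj i j i≢j _ z∈Bi z∈Bj

    σ-grounds-A : ∀ {y} → VarsAll A y → GroundT (σ y)
    σ-grounds-A {y} y∈A =
      let δ , θ≡σ₀δ = proj₂ σ₀-mgu θ θ-unifies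
      in subst GroundT (trans (sym (θ≡σ₀δ y)) (θ≡σ-on-A y∈A)) (ground-⟨⟩ δ (σ₀ y) (σ₀-grounds-A y∈A))

  compound-arg-has-deeper-partner : ∀ j {s z w} → s ∈ args (lookup B j) → IsCompound s →
    z ∈T s → w ∈T σ₀ z → ∃ λ u → u ∈A lookup A j × vdp (σ₀ z) <ℤ vdp (σ₀ u)
  compound-arg-has-deeper-partner j {fn f us} {z} {w} s∈ _ (arg z∈) w∈σ₀z
    with Pointwise-∈ (Pointwise.symmetric sym (σ₀-args j)) s∈
  ... | a , a∈ , s≡a with flat⇒var⊎ground a (vdps≤⇒vdp≤ _ (A-flat j) a∈)
  ... | inj₂ a-ground =
    ⊥-elim (ground-⟨⟩ σ₀ a a-ground w (subst (w ∈T_) s≡a (∈T-⟨⟩⁺ σ₀ (fn f us) (arg z∈) w∈σ₀z)))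
  ... | inj₁ (u , refl) =
    u , lose a∈ here , subst (vdp (σ₀ z) <ℤ_) (cong vdp s≡a) (vdp-var<vdp-⟨⟩-fn σ₀ f us z∈ w∈σ₀z)

  var-arg-has-deeper-partner : ∀ j {z w} → var z ∈ args (lookup B j) → w ∈T σ₀ z →
    ∃ λ u → u ∈A lookup A j × vdp (σ₀ z) <ℤ vdp (σ₀ u)
  var-arg-has-deeper-partner j {z} z∈Bj w∈σ₀z with B-shape j
  ... | inj₂ Bj-ground = ⊥-elim (Bj-ground z (lose z∈Bj here))
  ... | inj₁ Bj-compound with find Bj-compound
  ... | s , s∈ , s-compound , s-nonground with All.lookup (B-wc j) s∈
  ... | inj₁ s-ground = ⊥-elim (s-nonground s-ground)
  ... | inj₂ (inj₁ s-var) = ⊥-elim (var-not-compound s s-var s-compound)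
    where
    var-not-compound : ∀ t → IsVar t → ¬ IsCompound t
    var-not-compound (var _) _ ()
  ... | inj₂ (inj₂ (_ , vars-s≃vars-Bj)) = compound-arg-has-deeper-partner j s∈ s-compound
    (proj₂ (vars-s≃vars-Bj z) (lose z∈Bj here)) w∈σ₀z

  module _ {x} (x-top : Top x) {w₀} (w₀∈σ₀x : w₀ ∈T σ₀ x) where

    vars-Aσ⊆vars-σx : ∀ {j w} → x ∈A lookup A j → w ∈A (lookup A j ⟨ σ ⟩A) → w ∈T σ x
    vars-Aσ⊆vars-σx {j} {w} x∈Aj w∈Ajσ with find x∈Aj
    ... | a , a∈ , x∈a with flat⇒var⊎ground a (vdps≤⇒vdp≤ _ (A-flat j) a∈)
    ... | inj₂ a-ground = ⊥-elim (a-ground x x∈a)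
    ... | inj₁ (_ , refl) with x∈a
    ... | here with Pointwise-∈ (Pointwise-∩ (σ₀-args j) (σ-args j (x , x-top , x∈Aj))) a∈
    ... | t , t∈ , σ₀x≡tσ₀ , σx≡tσ with All.lookup (B-wc j) t∈
    ... | inj₁ t-ground = ⊥-elim (ground-⟨⟩ σ₀ t t-ground w₀ (subst (w₀ ∈T_) σ₀x≡tσ₀ w₀∈σ₀x))
    ... | inj₂ (inj₁ t-var) = ⊥-elim (variable-partner t t∈ t-var σ₀x≡tσ₀)
      where
      variable-partner : ∀ t → t ∈ args (lookup B j) → IsVar t → ¬ σ₀ x ≡ t ⟨ σ₀ ⟩
      variable-partner (var z) z∈Bj _ σ₀x≡σ₀z =
        let u , u∈Aj , deeper = var-arg-has-deeper-partner j z∈Bj (subst (w₀ ∈T_) σ₀x≡σ₀z w₀∈σ₀x)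
        in top-is-deepest x-top (j , u∈Aj) (subst (λ t → vdp t <ℤ vdp (σ₀ u)) (sym σ₀x≡σ₀z) deeper)
    ... | inj₂ (inj₂ (_ , vars-t≃vars-Bj)) =
      let z , z∈Bj , w∈σz = ∈A-⟨⟩⁻ σ (lookup B j) (subst (w ∈A_) (proj₁ σ-mgu j (x , x-top , x∈Aj)) w∈Ajσ)
      in subst (w ∈T_) (sym σx≡tσ) (∈T-⟨⟩⁺ σ t (proj₂ (vars-t≃vars-Bj z) z∈Bj) w∈σz)

  vars-σx≃vars-Cσ : ∀ {x} → Top x → (_∈T σ x) ≃V (_∈C (C ⟨ σ ⟩C))
  vars-σx≃vars-Cσ {x} x-top@((k , x∈Ak) , _) w = ∈C-⟨⟩⁺ σ C (∈A⇒∈C k x∈Ak) , vars-Cσ⊆vars-σx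
    where
    vars-Cσ⊆vars-σx : w ∈C (C ⟨ σ ⟩C) → w ∈T σ x
    vars-Cσ⊆vars-σx w∈Cσ with ∈C-⟨⟩⁻ σ C w∈Cσ
    ... | z , z∈C , w∈σz with proj₂ (co-occurring≃vars-C (k , x∈Ak) z) z∈C | ground-or-occurs (σ₀ x)
    ... | j , _ , z∈Aj   | inj₁ σ₀x-ground = ⊥-elim (σ-grounds-A x-top σ₀x-ground (j , z∈Aj) w w∈σz)
    ... | j , x∈Aj , z∈Aj | inj₂ (w₀ , w₀∈σ₀x) =
      vars-Aσ⊆vars-σx x-top w₀∈σ₀x x∈Aj (∈A-⟨⟩⁺ σ (lookup A j) z∈Aj w∈σz)

lemma5 : (prec : Precedence) (Sel : Clause → Literal → Set) (R : ResApp prec Sel) →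
    let open ResApp R in
    ∀ x → Top x →
    ((λ y → ∃ λ i → x ∈A lookup A i × y ∈A lookup A i) ≃V (_∈C C))
    × ((_∈T σ x) ≃V (_∈C (C ⟨ σ ⟩C)))
    × (∀ y → Top y → x ≢ y → (_∈T σ x) ≃V (_∈T σ y))
lemma5 prec Sel R x x-top =
    co-occurring≃vars-C R (proj₁ x-top)
  , vars-σx≃vars-Cσ R x-top
  , λ y y-top _ → ≃V-trans (vars-σx≃vars-Cσ R x-top) (≃V-sym (vars-σx≃vars-Cσ R y-top))
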